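{- There exist infinitely many strong Eulerian triples, i.e., infinitely many sets $\{x_1,x_2,x_3\}$ of three distinct rational numbers such that $x_1x_2+x_1+x_2$, $x_1x_3+x_1+x_3$, $x_2x_3+x_2+x_3$, $x_1^2+2x_1$, $x_2^2+2x_2$ and $x_3^2+2x_3$ are all squares of rational numbers. -}

module Defs where

open import Data.Rational using (ℚ; _+_; _*_; _<_; 1ℚ)
open import Data.Product using (Σ; ∃; _×_; _,_)
open import Relation.Binary.PropositionalEquality using (_≡_)
open import Data.Nat using (ℕ)
open import Function.Definitions using (Injective)

IsSquare : ℚ → Set
IsSquare q = ∃ λ r → r * r ≡ q

2ℚ : ℚ
2ℚ = 1ℚ + 1ℚ

-- A set {x₁,x₂,x₃} of three distinct rationals is represented canonically
-- by its increasing enumeration x₁ < x₂ < x₃.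
record IncTriple : Set where
  constructor triple
  field
    x₁ x₂ x₃ : ℚ
    x₁<x₂ : x₁ < x₂
    x₂<x₃ : x₂ < x₃

StrongEulerian : IncTriple → Set
StrongEulerian t =
  IsSquare (x₁ * x₂ + x₁ + x₂) ×
  IsSquare (x₁ * x₃ + x₁ + x₃) ×
  IsSquare (x₂ * x₃ + x₂ + x₃) ×
  IsSquare (x₁ * x₁ + 2ℚ * x₁) ×
  IsSquare (x₂ * x₂ + 2ℚ * x₂) ×
  IsSquare (x₃ * x₃ + 2ℚ * x₃)
  where open IncTriple t

SameSet : IncTriple → IncTriple → Set
SameSet s t = (IncTriple.x₁ s ≡ IncTriple.x₁ t) × (IncTriple.x₂ s ≡ IncTriple.x₂ t) × (IncTriple.x₃ s ≡ IncTriple.x₃ t)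

InfinitelyManyStrongEulerianTriples : Set
InfinitelyManyStrongEulerianTriples =
  Σ (ℕ → IncTriple) λ f →
    ((n : ℕ) → StrongEulerian (f n)) ×
    Injective _≡_ SameSet f

-- Take x₁ = 0: then x₁x₂ + x₁ + x₂ = x₂ and x₁² + 2x₁ = 0, so it suffices to find rationals
-- 0 < q < p such that p² + 2, q² + 2 and q²p² + q² + p² are squares, and to put x₂ = q²,
-- x₃ = p² (so that x₂(x₂ + 2) = q²(q² + 2), and likewise for x₃). For k = 5, 6, … take
-- p = P/U and q = p·N/S with the polynomials P, U, N, S in k below; each square condition
-- is then a polynomial identity once the denominators are cleared. Since 0 < N < S we get
-- 0 < q < p, and p = k/2 − 1/k is increasing in k, so the triples are distinct.
-- Positivity of a polynomial for k ≥ 5 is certified by the nonnegative coefficients of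
-- its expansion at k = j + 5.
module Submission where

open import Algebra.Bundles.Raw using (RawSemiring)
import Data.Integer as ℤ
open import Data.Empty using (⊥-elim)
open import Data.List using (List; []; _∷_)
open import Data.Nat as ℕ using (ℕ; zero; suc)
import Data.Nat.Literals
open import Data.Nat.Properties using (<-cmp; m<1+n⇒m<n∨m≡n)
open import Data.Product using (_,_)
open import Data.Rational using (ℚ; 0ℚ; 1ℚ; _<_; 1/_; Positive; NonNegative; positive; +-*-rawSemiring)
open import Data.Rational.Literals using (fromℤ)
open import Data.Rational.Properties
  using (*-identityʳ; +-identityʳ; +-monoʳ-<; *-monoˡ-<-pos; *-monoʳ-<-pos; <-trans; <-irrefl;
         positive⁻¹; pos⇒nonZero; *-inverseʳ; 1/pos⇒pos; pos*pos⇒pos; pos+nonNeg⇒pos;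
         nonNeg+nonNeg⇒nonNeg; nonNeg*nonNeg⇒nonNeg)
open import Data.Rational.Solver using (module +-*-Solver)
open import Data.Sum using (inj₁; inj₂)
open import Function using (id)
open import Level using (0ℓ)
open import Relation.Binary.Definitions using (tri<; tri≈; tri>)
open import Relation.Binary.PropositionalEquality
open ≡-Reasoning

open import Defs

open +-*-Solver using (Polynomial; con; _:+_; _:*_; _:=_; solve)

-- The polynomials are written once, over an arbitrary raw semiring with the constants
-- embedded by κ: at ℚ they are the functions used below, at the solver's syntax they
-- are the terms that let solve prove identities between them.
module Polynomials (R : RawSemiring 0ℓ 0ℓ) (κ : ℚ → RawSemiring.Carrier R) where
  open RawSemiring R
  open import Algebra.Definitions.RawSemiring R using (_^_)
  open import Agda.Builtin.FromNat using (Number; fromNat)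
  open import Agda.Builtin.FromNeg using (Negative; fromNeg)
  open import Data.Unit using (tt)

  private instance
    ℕ-number : Number ℕ
    ℕ-number = Data.Nat.Literals.number
    ℚ-number : Number ℚ
    ℚ-number = Data.Rational.Literals.number
    ℚ-negative : Negative ℚ
    ℚ-negative = Data.Rational.Literals.negative

  horner : List ℕ → Carrier → Carrier
  horner []       x = 0#
  horner (c ∷ cs) x = κ (fromℤ (ℤ.+ c)) + x * horner cs x

  k₀ : Carrier
  k₀ = κ 5

  P U B S N D W T E : Carrier → Carrier
  P k = k ^ 2 + κ -2
  U k = κ 2 * k
  B k = k ^ 2 + κ 2
  S k = κ 3 * k ^ 8 + κ -40 * k ^ 4 + κ 48
  N k = k ^ 8 + κ -16 * k ^ 6 + κ -56 * k ^ 4 + κ -64 * k ^ 2 + κ 16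
  D k = κ 2 * k ^ 8 + κ 16 * k ^ 6 + κ 16 * k ^ 4 + κ 64 * k ^ 2 + κ 32
  W k = k ^ 10 + κ 18 * k ^ 8 + κ -24 * k ^ 6 + κ -48 * k ^ 4 + κ 144 * k ^ 2 + κ 32
  T k = k ^ 12 + κ 68 * k ^ 8 + κ -272 * k ^ 4 + κ -64
  E k = κ 2 * k ^ 2 + κ 2 * k + κ 4

polynomials : ℕ → RawSemiring 0ℓ 0ℓ
polynomials n = record
  { Carrier = Polynomial n
  ; _≈_     = _≡_
  ; _+_     = _:+_
  ; _*_     = _:*_
  ; 0#      = con 0ℚ
  ; 1#      = con 1ℚ
  }

open import Data.Rational using (_+_; _*_)

open Polynomials +-*-rawSemiring id
open module Syntax {n} = Polynomials (polynomials n) con using ()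
  renaming (horner to :horner; k₀ to :k₀; P to :P; U to :U; B to :B; S to :S; N to :N; D to :D;
            W to :W; T to :T; E to :E)

1²≡1 : ∀ {e} → e ≡ 1ℚ → e * e ≡ 1ℚ
1²≡1 refl = refl

inverse-* : ∀ b c u z → b * u ≡ 1ℚ → c * z ≡ 1ℚ → (b * c) * (u * z) ≡ 1ℚ
inverse-* b c u z bu≡1 cz≡1 = begin
  (b * c) * (u * z) ≡⟨ solve 4 (λ b c u z → (b :* c) :* (u :* z) := (b :* u) :* (c :* z)) refl b c u z ⟩
  (b * u) * (c * z) ≡⟨ cong₂ _*_ bu≡1 cz≡1 ⟩
  1ℚ * 1ℚ           ∎

isSquare-[aw]²+c : ∀ c a b d w → a * a + c * (b * b) ≡ d * d → b * w ≡ 1ℚ →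
                   IsSquare ((a * w) * (a * w) + c)
isSquare-[aw]²+c c a b d w form bw≡1 = d * w , (begin
  (d * w) * (d * w)
    ≡⟨ solve 2 (λ d w → (d :* w) :* (d :* w) := (w :* w) :* (d :* d)) refl d w ⟩
  (w * w) * (d * d)
    ≡⟨ cong ((w * w) *_) form ⟨
  (w * w) * (a * a + c * (b * b))
    ≡⟨ solve 4 (λ a b c w → (w :* w) :* (a :* a :+ c :* (b :* b))
                          := (a :* w) :* (a :* w) :+ c :* ((b :* w) :* (b :* w))) refl a b c w ⟩
  (a * w) * (a * w) + c * ((b * w) * (b * w))
    ≡⟨ cong (λ e → (a * w) * (a * w) + c * e) (1²≡1 bw≡1) ⟩
  (a * w) * (a * w) + c * 1ℚ
    ≡⟨ cong (((a * w) * (a * w)) +_) (*-identityʳ c) ⟩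
  (a * w) * (a * w) + c ∎)

isSquare-q²p²+q²+p² : ∀ P N U S T u z → U * u ≡ 1ℚ → S * z ≡ 1ℚ →
  P * P * ((P * N) * (P * N) + (N * U) * (N * U) + (U * S) * (U * S)) ≡ T * T →
  let p = P * u ; q = p * (N * z) in IsSquare (q * q * (p * p) + q * q + p * p)
isSquare-q²p²+q²+p² P N U S T u z Uu≡1 Sz≡1 form = T * (u * (u * z)) , (begin
  (T * (u * (u * z))) * (T * (u * (u * z)))
    ≡⟨ solve 3 (λ T u z → (T :* (u :* (u :* z))) :* (T :* (u :* (u :* z)))
                        := (u :* u :* (u :* u) :* (z :* z)) :* (T :* T)) refl T u z ⟩
  (u * u * (u * u) * (z * z)) * (T * T)
    ≡⟨ cong ((u * u * (u * u) * (z * z)) *_) form ⟨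
  (u * u * (u * u) * (z * z)) * (P * P * ((P * N) * (P * N) + (N * U) * (N * U) + (U * S) * (U * S)))
    ≡⟨ solve 6 (λ P N U S u z →
         let p = P :* u ; q = p :* (N :* z) in
         (u :* u :* (u :* u) :* (z :* z))
           :* (P :* P :* ((P :* N) :* (P :* N) :+ (N :* U) :* (N :* U) :+ (U :* S) :* (U :* S)))
         := q :* q :* (p :* p) :+ q :* q :* ((U :* u) :* (U :* u))
              :+ p :* p :* ((U :* u) :* (U :* u)) :* ((S :* z) :* (S :* z))) refl P N U S u z ⟩
  q * q * (p * p) + q * q * ((U * u) * (U * u)) + p * p * ((U * u) * (U * u)) * ((S * z) * (S * z))
    ≡⟨ cong₂ (λ e f → q * q * (p * p) + q * q * e + p * p * e * f) (1²≡1 Uu≡1) (1²≡1 Sz≡1) ⟩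
  q * q * (p * p) + q * q * 1ℚ + p * p * 1ℚ * 1ℚ
    ≡⟨ solve 2 (λ p q → q :* q :* (p :* p) :+ q :* q :* con 1ℚ :+ p :* p :* con 1ℚ :* con 1ℚ
                      := q :* q :* (p :* p) :+ q :* q :+ p :* p) refl p q ⟩
  q * q * (p * p) + q * q + p * p ∎)
  where
  p = P * u
  q = p * (N * z)

isSquare-x²[x²+c] : ∀ c x → IsSquare (x * x + c) → IsSquare (x * x * (x * x) + c * (x * x))
isSquare-x²[x²+c] c x (y , y²≡x²+c) = x * y , (begin
  (x * y) * (x * y)     ≡⟨ solve 2 (λ x y → (x :* y) :* (x :* y) := (x :* x) :* (y :* y)) refl x y ⟩
  (x * x) * (y * y)     ≡⟨ cong ((x * x) *_) y²≡x²+c ⟩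
  (x * x) * (x * x + c) ≡⟨ solve 2 (λ c x → (x :* x) :* (x :* x :+ c)
                                          := x :* x :* (x :* x) :+ c :* (x :* x)) refl c x ⟩
  x * x * (x * x) + c * (x * x) ∎)

isSquare-0x+0+x : ∀ {x} → IsSquare x → IsSquare (0ℚ * x + 0ℚ + x)
isSquare-0x+0+x {x} = subst IsSquare (solve 1 (λ x → x := con 0ℚ :* x :+ con 0ℚ :+ x) refl x)

fraction-increment : ∀ a a′ b b′ e u u′ → b * u ≡ 1ℚ → b′ * u′ ≡ 1ℚ → a′ * b ≡ a * b′ + e →
                     a′ * u′ ≡ a * u + e * (u * u′)
fraction-increment a a′ b b′ e u u′ bu≡1 b′u′≡1 cross = begin
  a′ * u′                          ≡⟨ *-identityʳ (a′ * u′) ⟨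
  a′ * u′ * 1ℚ                     ≡⟨ cong ((a′ * u′) *_) bu≡1 ⟨
  a′ * u′ * (b * u)                ≡⟨ solve 4 (λ a′ b u u′ → a′ :* u′ :* (b :* u)
                                                           := (a′ :* b) :* (u :* u′)) refl a′ b u u′ ⟩
  (a′ * b) * (u * u′)              ≡⟨ cong (_* (u * u′)) cross ⟩
  (a * b′ + e) * (u * u′)          ≡⟨ solve 5 (λ a b′ e u u′ → (a :* b′ :+ e) :* (u :* u′)
                                                             := a :* u :* (b′ :* u′) :+ e :* (u :* u′)) refl a b′ e u u′ ⟩
  a * u * (b′ * u′) + e * (u * u′) ≡⟨ cong (λ t → a * u * t + e * (u * u′)) b′u′≡1 ⟩
  a * u * 1ℚ + e * (u * u′)        ≡⟨ cong (_+ e * (u * u′)) (*-identityʳ (a * u)) ⟩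
  a * u + e * (u * u′)             ∎

x<x+d : ∀ x d .{{_ : Positive d}} → x < x + d
x<x+d x d = subst (_< x + d) (+-identityʳ x) (+-monoʳ-< x (positive⁻¹ d))

square-mono-< : ∀ {a b} .{{_ : Positive a}} → a < b → a * a < b * b
square-mono-< {a} {b} a<b =
  <-trans (*-monoʳ-<-pos a a<b) (*-monoˡ-<-pos b {{positive (<-trans (positive⁻¹ a) a<b)}} a<b)

increasing⇒< : ∀ (f : ℕ → ℚ) → (∀ n → f n < f (suc n)) → ∀ {m n} → m ℕ.< n → f m < f n
increasing⇒< f step {m} {suc n} m<1+n with m<1+n⇒m<n∨m≡n m<1+n
... | inj₁ m<n  = <-trans (increasing⇒< f step m<n) (step n)
... | inj₂ refl = step m

increasing⇒injective : ∀ (f : ℕ → ℚ) → (∀ n → f n < f (suc n)) → ∀ {m n} → f m ≡ f n → m ≡ n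
increasing⇒injective f step {m} {n} fm≡fn with <-cmp m n
... | tri< m<n _ _ = ⊥-elim (<-irrefl fm≡fn (increasing⇒< f step m<n))
... | tri≈ _ m≡n _ = m≡n
... | tri> _ _ n<m = ⊥-elim (<-irrefl (sym fm≡fn) (increasing⇒< f step n<m))

horner-nonNegative : ∀ cs x .{{_ : NonNegative x}} → NonNegative (horner cs x)
horner-nonNegative []       x = _
horner-nonNegative (c ∷ cs) x =
  nonNeg+nonNeg⇒nonNeg (fromℤ (ℤ.+ c)) (x * horner cs x)
    {{nonNeg*nonNeg⇒nonNeg x (horner cs x) {{horner-nonNegative cs x}}}}

horner-positive : ∀ c cs x .{{_ : NonNegative x}} .{{_ : ℕ.NonZero c}} → Positive (horner (c ∷ cs) x)
horner-positive (suc c) cs x =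
  pos+nonNeg⇒pos (fromℤ (ℤ.+ suc c)) (x * horner cs x)
    {{nonNeg*nonNeg⇒nonNeg x (horner cs x) {{horner-nonNegative cs x}}}}

P²+2U²≡B² : ∀ k → P k * P k + 2ℚ * (U k * U k) ≡ B k * B k
P²+2U²≡B² = solve 1 (λ k →
  :P k :* :P k :+ con 2ℚ :* (:U k :* :U k) := :B k :* :B k) refl

[PN]²+2[US]²≡W² : ∀ k → (P k * N k) * (P k * N k) + 2ℚ * ((U k * S k) * (U k * S k)) ≡ W k * W k
[PN]²+2[US]²≡W² = solve 1 (λ k →
  (:P k :* :N k) :* (:P k :* :N k) :+ con 2ℚ :* ((:U k :* :S k) :* (:U k :* :S k))
  := :W k :* :W k) refl

P²[[PN]²+[NU]²+[US]²]≡T² : ∀ k →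
  P k * P k * ((P k * N k) * (P k * N k) + (N k * U k) * (N k * U k) + (U k * S k) * (U k * S k))
  ≡ T k * T k
P²[[PN]²+[NU]²+[US]²]≡T² = solve 1 (λ k →
  :P k :* :P k
    :* ((:P k :* :N k) :* (:P k :* :N k) :+ (:N k :* :U k) :* (:N k :* :U k) :+ (:U k :* :S k) :* (:U k :* :S k))
  := :T k :* :T k) refl

S≡N+D : ∀ k → S k ≡ N k + D k
S≡N+D = solve 1 (λ k → :S k := :N k :+ :D k) refl

P[k+1]U[k]≡P[k]U[k+1]+E[k] : ∀ k → P (k + 1ℚ) * U k ≡ P k * U (k + 1ℚ) + E k
P[k+1]U[k]≡P[k]U[k+1]+E[k] = solve 1 (λ k →
  :P (k :+ con 1ℚ) :* :U k := :P k :* :U (k :+ con 1ℚ) :+ :E k) refl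

fromℕ : ℕ → ℚ
fromℕ zero    = 0ℚ
fromℕ (suc n) = fromℕ n + 1ℚ

fromℕ-nonNegative : ∀ n → NonNegative (fromℕ n)
fromℕ-nonNegative zero    = _
fromℕ-nonNegative (suc n) = nonNeg+nonNeg⇒nonNeg (fromℕ n) {{fromℕ-nonNegative n}} 1ℚ

k[_] : ℕ → ℚ
k[ n ] = fromℕ n + k₀

k[1+n]≡k[n]+1 : ∀ n → k[ suc n ] ≡ k[ n ] + 1ℚ
k[1+n]≡k[n]+1 n = solve 1 (λ x → (x :+ con 1ℚ) :+ :k₀ := (x :+ :k₀) :+ con 1ℚ) refl (fromℕ n)

positive-by-shift : ∀ (f : ℚ → ℚ) c cs .{{_ : ℕ.NonZero c}} →
                    (∀ j → f (j + k₀) ≡ horner (c ∷ cs) j) → ∀ n → Positive (f k[ n ])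
positive-by-shift f c cs shift n =
  subst Positive (sym (shift (fromℕ n))) (horner-positive c cs (fromℕ n) {{fromℕ-nonNegative n}})

P>0 : ∀ n → Positive (P k[ n ])
P>0 = positive-by-shift P 23 (10 ∷ 1 ∷ [])
  (solve 1 (λ j → :P (j :+ :k₀) := :horner (23 ∷ 10 ∷ 1 ∷ []) j) refl)

U>0 : ∀ n → Positive (U k[ n ])
U>0 = positive-by-shift U 10 (2 ∷ [])
  (solve 1 (λ j → :U (j :+ :k₀) := :horner (10 ∷ 2 ∷ []) j) refl)

S>0 : ∀ n → Positive (S k[ n ])
S>0 = positive-by-shift S 1146923 (1855000 ∷ 1306500 ∷ 524200 ∷ 131210 ∷ 21000 ∷ 2100 ∷ 120 ∷ 3 ∷ [])
  (solve 1 (λ j → :S (j :+ :k₀)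
              := :horner (1146923 ∷ 1855000 ∷ 1306500 ∷ 524200 ∷ 131210 ∷ 21000 ∷ 2100 ∷ 120 ∷ 3 ∷ []) j) refl)

N>0 : ∀ n → Positive (N k[ n ])
N>0 = positive-by-shift N 104041 (296360 ∷ 279036 ∷ 133880 ∷ 37694 ∷ 6520 ∷ 684 ∷ 40 ∷ 1 ∷ [])
  (solve 1 (λ j → :N (j :+ :k₀)
              := :horner (104041 ∷ 296360 ∷ 279036 ∷ 133880 ∷ 37694 ∷ 6520 ∷ 684 ∷ 40 ∷ 1 ∷ []) j) refl)

D>0 : ∀ n → Positive (D k[ n ])
D>0 = positive-by-shift D 1042882 (1558640 ∷ 1027464 ∷ 390320 ∷ 93516 ∷ 14480 ∷ 1416 ∷ 80 ∷ 2 ∷ [])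
  (solve 1 (λ j → :D (j :+ :k₀)
              := :horner (1042882 ∷ 1558640 ∷ 1027464 ∷ 390320 ∷ 93516 ∷ 14480 ∷ 1416 ∷ 80 ∷ 2 ∷ []) j) refl)

E>0 : ∀ n → Positive (E k[ n ])
E>0 = positive-by-shift E 64 (22 ∷ 2 ∷ [])
  (solve 1 (λ j → :E (j :+ :k₀) := :horner (64 ∷ 22 ∷ 2 ∷ []) j) refl)

u z : ℕ → ℚ
u n = (1/ U k[ n ]) {{pos⇒nonZero (U k[ n ]) {{U>0 n}}}}
z n = (1/ S k[ n ]) {{pos⇒nonZero (S k[ n ]) {{S>0 n}}}}

U·u≡1 : ∀ n → U k[ n ] * u n ≡ 1ℚ
U·u≡1 n = *-inverseʳ (U k[ n ]) {{pos⇒nonZero (U k[ n ]) {{U>0 n}}}}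

S·z≡1 : ∀ n → S k[ n ] * z n ≡ 1ℚ
S·z≡1 n = *-inverseʳ (S k[ n ]) {{pos⇒nonZero (S k[ n ]) {{S>0 n}}}}

u>0 : ∀ n → Positive (u n)
u>0 n = 1/pos⇒pos (U k[ n ]) {{U>0 n}}

z>0 : ∀ n → Positive (z n)
z>0 n = 1/pos⇒pos (S k[ n ]) {{S>0 n}}

p r q : ℕ → ℚ
p n = P k[ n ] * u n
r n = N k[ n ] * z n
q n = p n * r n

p>0 : ∀ n → Positive (p n)
p>0 n = pos*pos⇒pos (P k[ n ]) {{P>0 n}} (u n) {{u>0 n}}

q>0 : ∀ n → Positive (q n)
q>0 n = pos*pos⇒pos (p n) {{p>0 n}} (r n) {{pos*pos⇒pos (N k[ n ]) {{N>0 n}} (z n) {{z>0 n}}}}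

r<1 : ∀ n → r n < 1ℚ
r<1 n = subst (r n <_) (S·z≡1 n) (*-monoˡ-<-pos (z n) {{z>0 n}} N<S)
  where
  N<S : N k[ n ] < S k[ n ]
  N<S = subst (N k[ n ] <_) (sym (S≡N+D k[ n ])) (x<x+d (N k[ n ]) (D k[ n ]) {{D>0 n}})

q<p : ∀ n → q n < p n
q<p n = subst (q n <_) (*-identityʳ (p n)) (*-monoʳ-<-pos (p n) {{p>0 n}} (r<1 n))

p<p[1+n] : ∀ n → p n < p (suc n)
p<p[1+n] n =
  subst (p n <_) (sym p[1+n]≡p[n]+Euu′) (x<x+d (p n) (E k[ n ] * (u n * u (suc n))) {{Euu′>0}})
  where
  cross : P k[ suc n ] * U k[ n ] ≡ P k[ n ] * U k[ suc n ] + E k[ n ]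
  cross = subst (λ k′ → P k′ * U k[ n ] ≡ P k[ n ] * U k′ + E k[ n ])
                (sym (k[1+n]≡k[n]+1 n)) (P[k+1]U[k]≡P[k]U[k+1]+E[k] k[ n ])
  p[1+n]≡p[n]+Euu′ : p (suc n) ≡ p n + E k[ n ] * (u n * u (suc n))
  p[1+n]≡p[n]+Euu′ = fraction-increment (P k[ n ]) (P k[ suc n ]) (U k[ n ]) (U k[ suc n ]) (E k[ n ])
    (u n) (u (suc n)) (U·u≡1 n) (U·u≡1 (suc n)) cross
  Euu′>0 : Positive (E k[ n ] * (u n * u (suc n)))
  Euu′>0 = pos*pos⇒pos (E k[ n ]) {{E>0 n}} (u n * u (suc n))
    {{pos*pos⇒pos (u n) {{u>0 n}} (u (suc n)) {{u>0 (suc n)}}}}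

q≡PN·uz : ∀ n → q n ≡ (P k[ n ] * N k[ n ]) * (u n * z n)
q≡PN·uz n = solve 4 (λ P N u z → (P :* u) :* (N :* z) := (P :* N) :* (u :* z)) refl
  (P k[ n ]) (N k[ n ]) (u n) (z n)

eulerianTriple : ℕ → IncTriple
eulerianTriple n = triple 0ℚ (q n * q n) (p n * p n)
  (positive⁻¹ (q n * q n) {{pos*pos⇒pos (q n) {{q>0 n}} (q n) {{q>0 n}}}})
  (square-mono-< {{q>0 n}} (q<p n))

eulerianTriple-strong : ∀ n → StrongEulerian (eulerianTriple n)
eulerianTriple-strong n =
  isSquare-0x+0+x (q n , refl) , isSquare-0x+0+x (p n , refl) , q²p²+q²+p²-square ,
  (0ℚ , refl) , isSquare-x²[x²+c] 2ℚ (q n) q²+2-square , isSquare-x²[x²+c] 2ℚ (p n) p²+2-square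
  where
  k = k[ n ]
  p²+2-square : IsSquare (p n * p n + 2ℚ)
  p²+2-square = isSquare-[aw]²+c 2ℚ (P k) (U k) (B k) (u n) (P²+2U²≡B² k) (U·u≡1 n)
  q²+2-square : IsSquare (q n * q n + 2ℚ)
  q²+2-square = subst (λ x → IsSquare (x * x + 2ℚ)) (sym (q≡PN·uz n))
    (isSquare-[aw]²+c 2ℚ (P k * N k) (U k * S k) (W k) (u n * z n) ([PN]²+2[US]²≡W² k)
      (inverse-* (U k) (S k) (u n) (z n) (U·u≡1 n) (S·z≡1 n)))
  q²p²+q²+p²-square : IsSquare (q n * q n * (p n * p n) + q n * q n + p n * p n)
  q²p²+q²+p²-square = isSquare-q²p²+q²+p² (P k) (N k) (U k) (S k) (T k) (u n) (z n)
    (U·u≡1 n) (S·z≡1 n) (P²[[PN]²+[NU]²+[US]²]≡T² k)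

theorem1p1 : InfinitelyManyStrongEulerianTriples
theorem1p1 = eulerianTriple , eulerianTriple-strong , λ (_ , _ , x₃≡x₃′) →
  increasing⇒injective (λ n → p n * p n) (λ n → square-mono-< {{p>0 n}} (p<p[1+n] n)) x₃≡x₃′
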